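{- Let $G$ be an $r$-regular graph with $v\ge 2$ vertices. If $G$ is $(a,d)$-distance antimagic, then $d\le r\,\frac{v-r}{v-1}$ and $a=\frac{r(v+1)-d(v-1)}{2}$.
   Context: For a finite simple graph $G$ with $v$ vertices and a bijection $f:V(G)\to\{1,\ldots,v\}$, the vertex-weight of $x$ is $w(x)=\sum_{y\in N(x)} f(y)$, $N(x)$ the set of neighbors of $x$. $f$ is an $(a,d)$-distance antimagic labeling, for fixed integers $a$ and $d\ge 0$, if the multiset of vertex-weights is $\{a,a+d,a+2d,\ldots,a+(v-1)d\}$; $G$ is $(a,d)$-distance antimagic if it admits such a labeling. -}

module Defs where

open import Data.Nat using (ℕ; suc)
open import Data.Fin using (Fin; toℕ)
open import Data.Bool using (Bool; true; false; if_then_else_)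
open import Data.List using (List; map; filter; length; allFin; upTo)
open import Data.Nat.ListAction using (sum)
open import Data.Integer as ℤ using (ℤ; +_; 0ℤ)
open import Data.Product using (_×_; Σ)
open import Relation.Binary.PropositionalEquality using (_≡_)
open import Relation.Nullary using (¬_)
open import Function.Bundles using (_⤖_; Bijection)
open import Data.List.Relation.Binary.Permutation.Propositional using (_↭_)

record Graph (v : ℕ) : Set where
  field
    adj      : Fin v → Fin v → Bool
    symmetric : ∀ x y → adj x y ≡ adj y x
    irreflexive : ∀ x → adj x x ≡ false
open Graph public

nbrs : ∀ {v} → Graph v → Fin v → List (Fin v)
nbrs G x = filter (λ y → Data.Bool._≟_ (adj G x y) true) (allFin _)
  where import Data.Bool

deg : ∀ {v} → Graph v → Fin v → ℕ
deg G x = length (nbrs G x)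

Regular : ∀ {v} → Graph v → ℕ → Set
Regular G r = ∀ x → deg G x ≡ r

-- a labeling f : V → {1,…,v} is encoded as a bijection Fin v ⤖ Fin v,
-- the label of x being toℕ (f x) + 1
label : ∀ {v} → (Fin v ⤖ Fin v) → Fin v → ℕ
label f x = suc (toℕ (Bijection.to f x))

weight : ∀ {v} → Graph v → (Fin v ⤖ Fin v) → Fin v → ℕ
weight G f x = sum (map (label f) (nbrs G x))

IsDistAntimagicLabeling : ∀ {v} → Graph v → ℤ → ℤ → (Fin v ⤖ Fin v) → Set
IsDistAntimagicLabeling {v} G a d f =
  map (λ x → + weight G f x) (allFin v)
    ↭ map (λ i → a ℤ.+ (+ i) ℤ.* d) (upTo v)

DistAntimagic : ∀ {v} → Graph v → ℤ → ℤ → Set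
DistAntimagic {v} G a d = Σ (Fin v ⤖ Fin v) (IsDistAntimagicLabeling G a d)

-- Every vertex has r neighbours, so summing all vertex weights counts every label exactly
-- r times: Σ w = r·v(v+1)/2.  The weights are a rearrangement of a, a+d, …, a+(v−1)d, whose
-- sum is va + d·v(v−1)/2; comparing the two sums gives 2a = r(v+1) − d(v−1).  Finally a is
-- itself a weight, i.e. a sum of r distinct labels, so 2a ≥ r(r+1), which turns the identity
-- into d(v−1) ≤ r(v−r).
module Submission where

open import Defs
open import Data.Nat using (ℕ; suc; _≥_; s≤s)
open import Data.Product using (_×_; _,_; ∃)
open import Relation.Binary.PropositionalEquality
  using (_≡_; refl; sym; trans; cong; cong₂; subst₂; setoid; module ≡-Reasoning)

open import Data.Bool using (Bool; true; false; _≟_)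
open import Data.Fin using (Fin; zero; suc; toℕ; inject₁; fromℕ)
open import Data.Fin.Properties using (toℕ-inject₁; toℕ-fromℕ)
open import Data.Fin.Permutation using (_⟨$⟩ˡ_; flip; inverseʳ)
open import Data.List using (List; []; _∷_; foldr; map; filter; length; allFin; tabulate; applyUpTo; upTo)
open import Data.List.Properties using (map-tabulate; length-upTo)
open import Data.List.Membership.Propositional.Properties using (∈-map⁻)
open import Data.List.Relation.Unary.Any using (here)
open import Data.List.Relation.Binary.Permutation.Propositional using (_↭_; ↭-sym; ↭⇒↭ₛ)
open import Data.List.Relation.Binary.Permutation.Propositional.Properties using (∈-resp-↭)
open import Data.List.Relation.Binary.Permutation.Setoid.Properties using (foldr-commMonoid)
open import Data.Nat.ListAction using (sum)
open import Function using (_∘_; id)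
open import Function.Bundles using (_⤖_)
open import Function.Properties.Bijection using (⤖⇒↔)

module Counting where
  open import Data.Nat using (zero; _+_; _*_; _≤_)
  open import Data.Nat.Properties
    using ( +-*-semiring; *-commutativeSemigroup; *-zeroʳ; *-distribˡ-+; +-identityʳ; +-suc
          ; +-monoˡ-≤; +-monoʳ-≤; *-monoˡ-≤; *-monoʳ-≤; n≤1+n; ≤-reflexive; ≤-trans; module ≤-Reasoning)
  open import Data.Nat.Tactic.RingSolver using (solve-∀)
  open import Algebra.Properties.Semiring.Sum +-*-semiring using (sum-syntax) public
  open import Algebra.Properties.Semiring.Sum +-*-semiring
    using (∑-comm; ∑-permute; *-distribˡ-sum; *-distribʳ-sum; sum-cong-≗; sum-init-last)
  open import Algebra.Properties.CommutativeSemigroup *-commutativeSemigroup using (x∙yz≈y∙xz)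

  𝟙 : Bool → ℕ
  𝟙 true  = 1
  𝟙 false = 0

  sum-tabulate : ∀ {n} (g : Fin n → ℕ) → sum (tabulate g) ≡ ∑[ i < n ] g i
  sum-tabulate {zero}  g = refl
  sum-tabulate {suc n} g = cong (g zero +_) (sum-tabulate (g ∘ suc))

  sum-map-allFin : ∀ {n} (g : Fin n → ℕ) → sum (map g (allFin n)) ≡ ∑[ i < n ] g i
  sum-map-allFin g = trans (cong sum (map-tabulate id g)) (sum-tabulate g)

  sum-applyUpTo : ∀ (f : ℕ → ℕ) n → sum (applyUpTo f n) ≡ ∑[ i < n ] f (toℕ i)
  sum-applyUpTo f zero    = refl
  sum-applyUpTo f (suc n) = cong (f 0 +_) (sum-applyUpTo (f ∘ suc) n)

  module _ {A : Set} (p : A → Bool) where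

    sum-map-filter : ∀ (g : A → ℕ) xs →
      sum (map g (filter (λ y → p y ≟ true) xs)) ≡ sum (map (λ y → 𝟙 (p y) * g y) xs)
    sum-map-filter g []       = refl
    sum-map-filter g (y ∷ ys) with p y
    ... | true  = cong₂ _+_ (sym (+-identityʳ (g y))) (sum-map-filter g ys)
    ... | false = sum-map-filter g ys

    length-filter : ∀ xs → length (filter (λ y → p y ≟ true) xs) ≡ sum (map (𝟙 ∘ p) xs)
    length-filter []       = refl
    length-filter (y ∷ ys) with p y
    ... | true  = cong suc (length-filter ys)
    ... | false = length-filter ys

  gauss : ∀ n → 2 * ∑[ i < n ] suc (toℕ i) ≡ n * suc n
  gauss zero    = refl
  gauss (suc n) = begin
    2 * ∑[ i < suc n ] suc (toℕ i)                              ≡⟨ cong (2 *_) (sum-init-last {n} (suc ∘ toℕ)) ⟩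
    2 * (∑[ i < n ] suc (toℕ (inject₁ i)) + suc (toℕ (fromℕ n))) ≡⟨ cong₂ (λ s t → 2 * (s + suc t))
                                                                     (sum-cong-≗ {n} (cong suc ∘ toℕ-inject₁)) (toℕ-fromℕ n) ⟩
    2 * (∑[ i < n ] suc (toℕ i) + suc n)                        ≡⟨ *-distribˡ-+ 2 (∑[ i < n ] suc (toℕ i)) (suc n) ⟩
    2 * ∑[ i < n ] suc (toℕ i) + 2 * suc n                      ≡⟨ cong (_+ 2 * suc n) (gauss n) ⟩
    n * suc n + 2 * suc n                                       ≡⟨ step n ⟩
    suc n * suc (suc n)                                         ∎
    where
    open ≡-Reasoning
    step : ∀ n → n * suc n + 2 * suc n ≡ suc n * suc (suc n)
    step = solve-∀

  -- c selects k of the numbers o+1, …, o+n; their sum is at least that of the k smallest ones.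
  ∑-select-≥ : ∀ {n} o (c : Fin n → Bool) → let k = ∑[ i < n ] 𝟙 (c i) in
    k * suc k + 2 * o * k ≤ 2 * ∑[ i < n ] (𝟙 (c i) * (o + suc (toℕ i)))
  ∑-select-≥ {zero}  o c = ≤-reflexive (*-zeroʳ (2 * o))
  ∑-select-≥ {suc n} o c
    with c zero | ∑-select-≥ (suc o) (c ∘ suc)
       | sum-cong-≗ {n} (λ i → cong (𝟙 (c (suc i)) *_) (sym (+-suc o (suc (toℕ i)))))
  ... | true | ih | shift = begin
    suc k * suc (suc k) + 2 * o * suc k       ≡⟨ regroup k o ⟩
    (k * suc k + 2 * suc o * k) + 2 * suc o   ≤⟨ +-monoˡ-≤ (2 * suc o) ih ⟩
    2 * T + 2 * suc o                         ≡⟨ cong (λ t → 2 * t + 2 * suc o) shift ⟩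
    2 * T′ + 2 * suc o                        ≡⟨ collect T′ o ⟩
    2 * (𝟙 true * (o + 1) + T′)               ∎
    where
    open ≤-Reasoning
    k = ∑[ i < n ] 𝟙 (c (suc i))
    T = ∑[ i < n ] (𝟙 (c (suc i)) * (suc o + suc (toℕ i)))
    T′ = ∑[ i < n ] (𝟙 (c (suc i)) * (o + suc (suc (toℕ i))))
    regroup : ∀ k o → suc k * suc (suc k) + 2 * o * suc k ≡ (k * suc k + 2 * suc o * k) + 2 * suc o
    regroup = solve-∀
    collect : ∀ t o → 2 * t + 2 * suc o ≡ 2 * (1 * (o + 1) + t)
    collect = solve-∀
  ... | false | ih | shift =
    ≤-trans (+-monoʳ-≤ (k * suc k) (*-monoˡ-≤ k (*-monoʳ-≤ 2 (n≤1+n o))))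
            (≤-trans ih (≤-reflexive (cong (2 *_) shift)))
    where k = ∑[ i < n ] 𝟙 (c (suc i))

  ∑-label : ∀ {v} (f : Fin v ⤖ Fin v) → 2 * ∑[ x < v ] label f x ≡ v * suc v
  ∑-label {v} f = trans (cong (2 *_) (sym (∑-permute (suc ∘ toℕ) (⤖⇒↔ f)))) (gauss v)

  module _ {v} (G : Graph v) where

    deg≡∑ : ∀ x → deg G x ≡ ∑[ y < v ] 𝟙 (adj G x y)
    deg≡∑ x = trans (length-filter (adj G x) (allFin v)) (sum-map-allFin (𝟙 ∘ adj G x))

    weight≡∑ : ∀ f x → weight G f x ≡ ∑[ y < v ] (𝟙 (adj G x y) * label f y)
    weight≡∑ f x = trans (sum-map-filter (adj G x) (label f) (allFin v))
                         (sum-map-allFin {v} (λ y → 𝟙 (adj G x y) * label f y))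

    module _ {r} (regular : Regular G r) where

      ∑-adj-∑ : ∀ (g : Fin v → ℕ) → ∑[ x < v ] ∑[ y < v ] (𝟙 (adj G x y) * g y) ≡ r * ∑[ y < v ] g y
      ∑-adj-∑ g = begin
        ∑[ x < v ] ∑[ y < v ] (𝟙 (adj G x y) * g y) ≡⟨ ∑-comm (λ x y → 𝟙 (adj G x y) * g y) ⟩
        ∑[ y < v ] ∑[ x < v ] (𝟙 (adj G x y) * g y) ≡⟨ sum-cong-≗ {v} column ⟩
        ∑[ y < v ] (r * g y)                        ≡⟨ *-distribˡ-sum r g ⟨
        r * ∑[ y < v ] g y                          ∎
        where
        open ≡-Reasoning
        column : ∀ y → ∑[ x < v ] (𝟙 (adj G x y) * g y) ≡ r * g y
        column y = begin
          ∑[ x < v ] (𝟙 (adj G x y) * g y) ≡⟨ sum-cong-≗ {v} (λ x → cong (λ b → 𝟙 b * g y) (symmetric G x y)) ⟩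
          ∑[ x < v ] (𝟙 (adj G y x) * g y) ≡⟨ *-distribʳ-sum (g y) (𝟙 ∘ adj G y) ⟨
          ∑[ x < v ] 𝟙 (adj G y x) * g y   ≡⟨ cong (_* g y) (trans (sym (deg≡∑ y)) (regular y)) ⟩
          r * g y                          ∎

      ∑-weight : ∀ f → 2 * ∑[ x < v ] weight G f x ≡ r * (v * suc v)
      ∑-weight f = begin
        2 * ∑[ x < v ] weight G f x                                 ≡⟨ cong (2 *_) (sum-cong-≗ {v} (weight≡∑ f)) ⟩
        2 * ∑[ x < v ] ∑[ y < v ] (𝟙 (adj G x y) * label f y)        ≡⟨ cong (2 *_) (∑-adj-∑ (label f)) ⟩
        2 * (r * ∑[ y < v ] label f y)                              ≡⟨ x∙yz≈y∙xz 2 r _ ⟩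
        r * (2 * ∑[ y < v ] label f y)                              ≡⟨ cong (r *_) (∑-label f) ⟩
        r * (v * suc v)                                             ∎
        where open ≡-Reasoning

      weight-≥ : ∀ f x → r * suc r ≤ 2 * weight G f x
      weight-≥ f x = begin
        r * suc r                                      ≡⟨ cong (λ k → k * suc k) deg-reindexed ⟩
        k * suc k                                      ≡⟨ +-identityʳ (k * suc k) ⟨
        k * suc k + 2 * 0 * k                          ≤⟨ ∑-select-≥ 0 c ⟩
        2 * ∑[ i < v ] (𝟙 (c i) * suc (toℕ i))          ≡⟨ cong (2 *_) weight-reindexed ⟨
        2 * weight G f x                               ∎
        where
        open ≤-Reasoning
        π = ⤖⇒↔ f
        c : Fin v → Bool
        c i = adj G x (π ⟨$⟩ˡ i)
        k = ∑[ i < v ] 𝟙 (c i)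
        deg-reindexed : r ≡ k
        deg-reindexed = trans (sym (regular x)) (trans (deg≡∑ x) (∑-permute (𝟙 ∘ adj G x) (flip π)))
        weight-reindexed : weight G f x ≡ ∑[ i < v ] (𝟙 (c i) * suc (toℕ i))
        weight-reindexed = trans (weight≡∑ f x) (trans (∑-permute _ (flip π))
          (sum-cong-≗ {v} (λ i → cong (λ j → 𝟙 (c i) * suc (toℕ j)) (inverseʳ π))))

open Counting

open import Data.Integer using (ℤ; +_; _+_; _*_; _-_; _≤_; 0ℤ; +≤+)
open import Data.Integer.Properties
  using (+-0-isCommutativeMonoid; +-identityʳ; +-monoʳ-≤; neg-mono-≤; pos-*; *-cancelˡ-≡; module ≤-Reasoning)
open import Data.Integer.Tactic.RingSolver using (solve-∀)

sumℤ : List ℤ → ℤ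
sumℤ = foldr _+_ 0ℤ

sumℤ-↭ : ∀ {xs ys} → xs ↭ ys → sumℤ xs ≡ sumℤ ys
sumℤ-↭ p = foldr-commMonoid (setoid ℤ) +-0-isCommutativeMonoid (↭⇒↭ₛ p)

sumℤ-map-pos : ∀ {A : Set} (g : A → ℕ) xs → sumℤ (map (λ x → + g x) xs) ≡ + sum (map g xs)
sumℤ-map-pos g []       = refl
sumℤ-map-pos g (x ∷ xs) = cong (λ s → + g x + s) (sumℤ-map-pos g xs)

sumℤ-map-affine : ∀ (a d : ℤ) ns → sumℤ (map (λ i → a + + i * d) ns) ≡ + length ns * a + + sum ns * d
sumℤ-map-affine a d []       = empty a d
  where
  empty : ∀ a d → 0ℤ ≡ + 0 * a + + 0 * d
  empty = solve-∀
sumℤ-map-affine a d (n ∷ ns) =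
  trans (cong (λ s → a + + n * d + s) (sumℤ-map-affine a d ns)) (step a d (+ n) (+ length ns) (+ sum ns))
  where
  step : ∀ a d n l s → a + n * d + (l * a + s * d) ≡ (+ 1 + l) * a + (n + s) * d
  step = solve-∀

antimagic-∑-weight : ∀ {v} (G : Graph v) {a d f} → IsDistAntimagicLabeling G a d f →
  + ∑[ x < v ] weight G f x ≡ + v * a + + ∑[ i < v ] toℕ i * d
antimagic-∑-weight {v} G {a} {d} {f} antimagic = begin
  + ∑[ x < v ] weight G f x                        ≡⟨ cong +_ (sum-map-allFin (weight G f)) ⟨
  + sum (map (weight G f) (allFin v))              ≡⟨ sumℤ-map-pos (weight G f) (allFin v) ⟨
  sumℤ (map (λ x → + weight G f x) (allFin v))     ≡⟨ sumℤ-↭ antimagic ⟩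
  sumℤ (map (λ i → a + + i * d) (upTo v))          ≡⟨ sumℤ-map-affine a d (upTo v) ⟩
  + length (upTo v) * a + + sum (upTo v) * d       ≡⟨ cong₂ (λ l s → + l * a + + s * d)
                                                             (length-upTo v) (sum-applyUpTo id v) ⟩
  + v * a + + ∑[ i < v ] toℕ i * d                 ∎
  where open ≡-Reasoning

a-is-weight : ∀ {n} (G : Graph (suc n)) {a d f} → IsDistAntimagicLabeling G a d f →
  ∃ λ x → + weight G f x ≡ a
a-is-weight G {a} antimagic with ∈-map⁻ _ (∈-resp-↭ (↭-sym antimagic) (here refl))
... | x , _ , a+0≡w = x , trans (sym a+0≡w) (+-identityʳ a)

V*2a≡V*[r[V+1]-d[V-1]] : ∀ {a d W S} r V →
  W ≡ V * a + S * d → + 2 * W ≡ r * (V * (+ 1 + V)) → + 2 * S ≡ (V - + 1) * V →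
  V * (+ 2 * a) ≡ V * (r * (V + + 1) - d * (V - + 1))
V*2a≡V*[r[V+1]-d[V-1]] {a} {d} {W} {S} r V W≡ 2W≡ 2S≡ = begin
  V * (+ 2 * a)                               ≡⟨ expand V a S d ⟩
  + 2 * (V * a + S * d) - + 2 * S * d         ≡⟨ cong₂ (λ w s → + 2 * w - s * d) (sym W≡) 2S≡ ⟩
  + 2 * W - (V - + 1) * V * d                 ≡⟨ cong (λ t → t - (V - + 1) * V * d) 2W≡ ⟩
  r * (V * (+ 1 + V)) - (V - + 1) * V * d     ≡⟨ factor r V d ⟩
  V * (r * (V + + 1) - d * (V - + 1))         ∎
  where
  open ≡-Reasoning
  expand : ∀ V a S d → V * (+ 2 * a) ≡ + 2 * (V * a + S * d) - + 2 * S * d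
  expand = solve-∀
  factor : ∀ r V d → r * (V * (+ 1 + V)) - (V - + 1) * V * d ≡ V * (r * (V + + 1) - d * (V - + 1))
  factor = solve-∀

d[V-1]≤r[V-r] : ∀ {a d} r V → + 2 * a ≡ r * (V + + 1) - d * (V - + 1) → r * (+ 1 + r) ≤ + 2 * a →
  d * (V - + 1) ≤ r * (V - r)
d[V-1]≤r[V-r] {a} {d} r V 2a≡ r[r+1]≤2a = begin
  d * (V - + 1)                               ≡⟨ cancel (r * (V + + 1)) (d * (V - + 1)) ⟩
  r * (V + + 1) - (r * (V + + 1) - d * (V - + 1)) ≡⟨ cong (λ t → r * (V + + 1) - t) 2a≡ ⟨
  r * (V + + 1) - + 2 * a                     ≤⟨ +-monoʳ-≤ (r * (V + + 1)) (neg-mono-≤ r[r+1]≤2a) ⟩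
  r * (V + + 1) - r * (+ 1 + r)               ≡⟨ factor r V ⟩
  r * (V - r)                                 ∎
  where
  open ≤-Reasoning
  cancel : ∀ x y → y ≡ x - (x - y)
  cancel = solve-∀
  factor : ∀ r V → r * (V + + 1) - r * (+ 1 + r) ≡ r * (V - r)
  factor = solve-∀

lemma4 : (v r : ℕ) (G : Graph v) (a d : ℤ) → v ≥ 2 → Regular G r →
    0ℤ ≤ d → DistAntimagic G a d →
    (d * (+ v - + 1) ≤ + r * (+ v - + r))
      × (+ 2 * a ≡ + r * (+ v + + 1) - d * (+ v - + 1))
lemma4 (suc n) r G a d (s≤s _) regular _ (f , antimagic) =
  d[V-1]≤r[V-r] {a} {d} (+ r) (+ suc n) 2a≡ r[r+1]≤2a , 2a≡
  where
  W S : ℕ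
  W = ∑[ x < suc n ] weight G f x
  S = ∑[ i < suc n ] toℕ i
  2W≡ : + 2 * + W ≡ + r * (+ suc n * (+ 1 + + suc n))
  2W≡ = trans (sym (pos-* 2 W)) (trans (cong +_ (∑-weight G regular f))
          (trans (pos-* r _) (cong (+ r *_) (pos-* (suc n) (suc (suc n))))))
  2S≡ : + 2 * + S ≡ (+ suc n - + 1) * + suc n
  2S≡ = trans (sym (pos-* 2 S)) (trans (cong +_ (gauss n)) (pos-* n (suc n)))
  2a≡ : + 2 * a ≡ + r * (+ suc n + + 1) - d * (+ suc n - + 1)
  2a≡ = *-cancelˡ-≡ (+ suc n) _ _
          (V*2a≡V*[r[V+1]-d[V-1]] {a} {d} {+ W} {+ S} (+ r) (+ suc n)
            (antimagic-∑-weight G {a} {d} {f} antimagic) 2W≡ 2S≡)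
  r[r+1]≤2a : + r * (+ 1 + + r) ≤ + 2 * a
  r[r+1]≤2a with a-is-weight G {a} {d} {f} antimagic
  ... | x , w≡a = subst₂ _≤_ (pos-* r (suc r)) (trans (pos-* 2 (weight G f x)) (cong (+ 2 *_) w≡a))
                    (+≤+ (weight-≥ G regular f x))
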